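{- Let $\nu\ge1$ and $n\ge0$ be integers with $n$ odd or $\nu$ even. Then \[ (-1)^\nu\left(pp(n)+2\sum_{\tau=1}^{\nu}(-1)^\tau pp(n-\tau^2)\right)\ge0, \] with strict inequality if $n\ge(\nu+1)^2$.
   Context: $pp(n)$ is the number of bipartitions of $n$, i.e. pairs $(\pi_1,\pi_2)$ of partitions whose part sums add up to $n$; $pp(x)=0$ for $x<0$. -}

module Defs where

open import Data.Nat using (ℕ; zero; suc; _+_; _*_; _∸_; _<ᵇ_)
open import Data.Bool using (if_then_else_)
open import Data.Integer using (ℤ; +_; -_) renaming (_+_ to _+ℤ_; _*_ to _*ℤ_)

-- pk n k = number of partitions of n into parts of size at most k.
-- Recursion on k: choose the multiplicity j of the part k (j*k ≤ n),
-- then partition the remainder n - j*k into parts of size at most k-1.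
-- multSum n k j m = Σ_{i=0}^{j} [i*(suc k) ≤ n] * pk (n - i*(suc k)) k, with pk at level k given as m.
pk : ℕ → ℕ → ℕ
multSum : (ℕ → ℕ) → ℕ → ℕ → ℕ → ℕ
multSum f n s zero    = f n
multSum f n s (suc j) = (if n <ᵇ suc j * s then 0 else f (n ∸ suc j * s)) + multSum f n s j
pk zero    zero    = 1
pk (suc n) zero    = 0
pk n       (suc k) = multSum (λ m → pk m k) n (suc k) n

p : ℕ → ℕ
p n = pk n n

-- pp n = number of bipartitions of n = number of pairs (π₁ , π₂) of partitions
-- with |π₁| + |π₂| = n, i.e. Σ_{k=0}^{n} p(k) p(n-k).
conv : ℕ → ℕ → ℕ
conv n zero    = p 0 * p n
conv n (suc j) = p (suc j) * p (n ∸ suc j) + conv n j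

pp : ℕ → ℕ
pp n = conv n n

-- pp extended to integer arguments x = n - m, with pp(x) = 0 for x < 0
ppSub : ℕ → ℕ → ℕ
ppSub n m = if n <ᵇ m then 0 else pp (n ∸ m)

sgn : ℕ → ℤ
sgn zero    = + 1
sgn (suc k) = - sgn k

altSum : ℕ → ℕ → ℤ
altSum n zero    = + 0
altSum n (suc t) = altSum n t +ℤ sgn (suc t) *ℤ + ppSub n (suc t * suc t)

D : ℕ → ℕ → ℤ
D ν n = sgn ν *ℤ (+ pp n +ℤ + 2 *ℤ altSum n ν)

open import Data.List using (List; map; upTo)
open import Relation.Binary.PropositionalEquality using (_≡_; refl)
private
  chk1 : map p (upTo 8) ≡ 1 Data.List.∷ 1 Data.List.∷ 2 Data.List.∷ 3 Data.List.∷ 5 Data.List.∷ 7 Data.List.∷ 11 Data.List.∷ 15 Data.List.∷ Data.List.[]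
  chk1 = refl
  chk2 : map pp (upTo 6) ≡ 1 Data.List.∷ 2 Data.List.∷ 5 Data.List.∷ 10 Data.List.∷ 20 Data.List.∷ 36 Data.List.∷ Data.List.[]
  chk2 = refl

-- Write F a b (ppk a b below) for 1/((q;q)_a (q;q)_b), the generating series of bipartitions whose parts are
-- bounded by a and b, and θ k for the truncated theta quotient
-- Σ_{i=0}^{2k} (-1)^(i-k) q^((i-k)²) F i (2k-i). Splitting every summand of θ (k+1) with the
-- recurrence F (a+1) b = F a b + q^(a+1) F (a+1) b and its mirror image, the pieces telescope to
-- θ (k+1) = θ k + q^(2k+2) θ (k+1); hence θ k = 1/(q²;q²)_k, whose coefficients are nonnegative and
-- vanish at odd powers of q. When 2n ≤ K the coefficient of q^n in θ K is
-- pp(n) + 2 Σ_{τ=1}^{K} (-1)^τ pp(n-τ²). Cutting this sum at ν gives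
-- (-1)^ν (pp(n) + 2 Σ_{τ=1}^{ν} (-1)^τ pp(n-τ²)) = (-1)^ν [q^n] θ K + 2 T, where
-- T = pp(n-(ν+1)²) - pp(n-(ν+2)²) + ⋯ is an alternating sum of a decreasing sequence, so T ≥ 0,
-- with T > 0 as soon as n ≥ (ν+1)², since pp is strictly increasing.

module Submission where

open import Defs
open import Data.Bool using (true; false; if_then_else_)
open import Data.Product using (_,_)
open import Function using (_∘_)
open import Relation.Binary.PropositionalEquality

module Partitions where

  open import Data.Nat using (ℕ; zero; suc; _+_; _*_; _∸_; _≤_; _<_; _<ᵇ_; z≤n; s≤s; z<s; s<s)
  open import Data.Nat.Properties
  open import Data.Nat.Induction using (<-rec)
  open import Algebra.Properties.CommutativeSemigroup +-commutativeSemigroup using (x∙yz≈y∙xz)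

  shift : {A : Set} → A → ℕ → (ℕ → A) → ℕ → A
  shift z s f n = if n <ᵇ s then z else f (n ∸ s)

  data Offset (s n : ℕ) : Set where
    below : n < s → Offset s n
    above : ∀ m → n ≡ s + m → Offset s n

  offset : ∀ s n → Offset s n
  offset zero    n       = above n refl
  offset (suc s) zero    = below z<s
  offset (suc s) (suc n) with offset s n
  ... | below n<s  = below (s<s n<s)
  ... | above m eq = above m (cong suc eq)

  m+n≮ᵇm : ∀ m n → (m + n <ᵇ m) ≡ false
  m+n≮ᵇm zero    n = refl
  m+n≮ᵇm (suc m) n = m+n≮ᵇm m n

  module _ {A : Set} {z : A} where

    shift-below : ∀ s f {n} → n < s → shift z s f n ≡ z
    shift-below s f {n} n<s with n <ᵇ s | <⇒<ᵇ n<s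
    ... | true | _ = refl

    shift-above : ∀ s f m → shift z s f (s + m) ≡ f m
    shift-above s f m rewrite m+n≮ᵇm s m | m+n∸m≡n s m = refl

    shift-cong : ∀ s {f g} n → (∀ m → n ≡ s + m → f m ≡ g m) → shift z s f n ≡ shift z s g n
    shift-cong s {f} {g} n f≡g with offset s n
    ... | below n<s  = trans (shift-below s f n<s) (sym (shift-below s g n<s))
    ... | above m refl = trans (shift-above s f m) (trans (f≡g m refl) (sym (shift-above s g m)))

    shift-shift : ∀ a b f n → shift z a (shift z b f) n ≡ shift z (a + b) f n
    shift-shift a b f n with offset a n
    ... | below n<a = trans (shift-below a (shift z b f) n<a) (sym (shift-below (a + b) f (<-≤-trans n<a (m≤m+n a b))))
    ... | above m refl with offset b m
    ...   | below m<b = begin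
            shift z a (shift z b f) (a + m) ≡⟨ shift-above a (shift z b f) m ⟩
            shift z b f m                   ≡⟨ shift-below b f m<b ⟩
            z                               ≡⟨ shift-below (a + b) f (+-monoʳ-< a m<b) ⟨
            shift z (a + b) f (a + m)       ∎
      where open ≡-Reasoning
    ...   | above r refl = begin
            shift z a (shift z b f) (a + (b + r)) ≡⟨ shift-above a (shift z b f) (b + r) ⟩
            shift z b f (b + r)                   ≡⟨ shift-above b f r ⟩
            f r                                   ≡⟨ shift-above (a + b) f r ⟨
            shift z (a + b) f (a + b + r)         ≡⟨ cong (shift z (a + b) f) (+-assoc a b r) ⟩
            shift z (a + b) f (a + (b + r))       ∎
      where open ≡-Reasoning

    shift-zipWith : ∀ (_∙_ : A → A → A) → z ∙ z ≡ z → ∀ s f g n →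
      shift z s (λ m → f m ∙ g m) n ≡ shift z s f n ∙ shift z s g n
    shift-zipWith _∙_ z∙z≡z s f g n with n <ᵇ s
    ... | true  = sym z∙z≡z
    ... | false = refl

  shift-map : ∀ {A B : Set} {z : A} {z′ : B} (h : A → B) → h z ≡ z′ → ∀ s f n →
    shift z′ s (h ∘ f) n ≡ h (shift z s f n)
  shift-map h hz≡z′ s f n with n <ᵇ s
  ... | true  = sym hz≡z′
  ... | false = refl

  -- Partitions with bounded parts

  multSum-suc : ∀ f n s j → multSum f n s (suc j) ≡ f n + shift 0 s (λ m → multSum f m s j) n
  multSum-suc f n s zero = begin
    shift 0 (s + 0) f n + f n ≡⟨ cong (λ t → shift 0 t f n + f n) (+-identityʳ s) ⟩
    shift 0 s f n + f n       ≡⟨ +-comm _ (f n) ⟩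
    f n + shift 0 s f n       ∎
    where open ≡-Reasoning
  multSum-suc f n s (suc j) = begin
    shift 0 (s + suc j * s) f n + multSum f n s (suc j)
      ≡⟨ cong₂ _+_ (sym (shift-shift s (suc j * s) f n)) (multSum-suc f n s j) ⟩
    shift 0 s (shift 0 (suc j * s) f) n + (f n + shift 0 s (λ m → multSum f m s j) n)
      ≡⟨ x∙yz≈y∙xz (shift 0 s (shift 0 (suc j * s) f) n) (f n) _ ⟩
    f n + (shift 0 s (shift 0 (suc j * s) f) n + shift 0 s (λ m → multSum f m s j) n)
      ≡⟨ cong (f n +_) (shift-zipWith _+_ refl s (shift 0 (suc j * s) f) (λ m → multSum f m s j) n) ⟨
    f n + shift 0 s (λ m → multSum f m s (suc j)) n
      ∎
    where open ≡-Reasoning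

  multSum-stable : ∀ f m s d → multSum f m (suc s) (d + m) ≡ multSum f m (suc s) m
  multSum-stable f m s zero    = refl
  multSum-stable f m s (suc d) =
    cong₂ _+_ (shift-below (suc (d + m) * suc s) f m<) (multSum-stable f m s d)
    where
    m< : m < suc (d + m) * suc s
    m< = <-≤-trans (s≤s (m≤n+m m d)) (m≤m*n (suc (d + m)) (suc s))

  pk-suc : ∀ n a → pk n (suc a) ≡ multSum (λ m → pk m a) n (suc a) n
  pk-suc zero    a = refl
  pk-suc (suc n) a = refl

  -- Conditioning on whether a part equal to a + 1 occurs.
  pk-rec : ∀ n a → pk n (suc a) ≡ pk n a + shift 0 (suc a) (λ m → pk m (suc a)) n
  pk-rec zero    a = sym (+-identityʳ _)
  pk-rec (suc n) a = trans (multSum-suc (λ m → pk m a) (suc n) (suc a) n)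
    (cong (pk (suc n) a +_) (shift-cong (suc a) (suc n) multSum≡pk))
    where
    multSum≡pk : ∀ m → suc n ≡ suc a + m → multSum (λ m → pk m a) m (suc a) n ≡ pk m (suc a)
    multSum≡pk m eq = begin
      multSum (λ m → pk m a) m (suc a) n            ≡⟨ cong (multSum (λ m → pk m a) m (suc a)) (m∸n+n≡m m≤n) ⟨
      multSum (λ m → pk m a) m (suc a) (n ∸ m + m)  ≡⟨ multSum-stable (λ m → pk m a) m a (n ∸ m) ⟩
      multSum (λ m → pk m a) m (suc a) m            ≡⟨ pk-suc m a ⟨
      pk m (suc a)                                  ∎
      where
      open ≡-Reasoning
      m≤n : m ≤ n
      m≤n = m+n≤o⇒n≤o a (≤-reflexive (suc-injective (sym eq)))

  pk-suc-stable : ∀ {n a} → n ≤ a → pk n (suc a) ≡ pk n a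
  pk-suc-stable {n} {a} n≤a = begin
    pk n (suc a)                                     ≡⟨ pk-rec n a ⟩
    pk n a + shift 0 (suc a) (λ m → pk m (suc a)) n
      ≡⟨ cong (pk n a +_) (shift-below (suc a) (λ m → pk m (suc a)) (s≤s n≤a)) ⟩
    pk n a + 0                                       ≡⟨ +-identityʳ _ ⟩
    pk n a                                           ∎
    where open ≡-Reasoning

  pk-stable : ∀ {n a} → n ≤ a → pk n a ≡ p n
  pk-stable {n} {a} n≤a with m≤n⇒∃[o]m+o≡n n≤a
  ... | d , refl = pk-stable-+ d
    where
    pk-stable-+ : ∀ d → pk n (n + d) ≡ p n
    pk-stable-+ zero    = cong (pk n) (+-identityʳ n)
    pk-stable-+ (suc d) = trans (cong (pk n) (+-suc n d)) (trans (pk-suc-stable (m≤m+n n d)) (pk-stable-+ d))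

  pk-1 : ∀ n → pk n 1 ≡ 1
  pk-1 zero    = refl
  pk-1 (suc n) = trans (pk-rec (suc n) 0) (pk-1 n)

  pk-positive : ∀ n a → 0 < pk n (suc a)
  pk-positive n zero    = ≤-reflexive (sym (pk-1 n))
  pk-positive n (suc a) = ≤-trans (pk-positive n a) (≤-trans (m≤m+n _ _) (≤-reflexive (sym (pk-rec n (suc a)))))

  shift-suc-mono : ∀ s (g : ℕ → ℕ) n → (∀ m → m < n → g m ≤ g (suc m)) →
    shift 0 (suc s) g n ≤ shift 0 (suc s) g (suc n)
  shift-suc-mono s g n g-mono with offset (suc s) n
  ... | below n<1+s = ≤-trans (≤-reflexive (shift-below (suc s) g n<1+s)) z≤n
  ... | above m refl = begin
    shift 0 (suc s) g (suc s + m)    ≡⟨ shift-above (suc s) g m ⟩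
    g m                              ≤⟨ g-mono m (s≤s (m≤n+m m s)) ⟩
    g (suc m)                        ≡⟨ shift-above (suc s) g (suc m) ⟨
    shift 0 (suc s) g (suc s + suc m) ≡⟨ cong (shift 0 (suc s) g) (+-suc (suc s) m) ⟩
    shift 0 (suc s) g (suc (suc s + m)) ∎
    where open ≤-Reasoning

  pk-mono : ∀ n a → pk n (suc a) ≤ pk (suc n) (suc a)
  pk-mono = <-rec (λ n → ∀ a → pk n (suc a) ≤ pk (suc n) (suc a)) step
    where
    step : ∀ n → (∀ {m} → m < n → ∀ a → pk m (suc a) ≤ pk (suc m) (suc a)) →
      ∀ a → pk n (suc a) ≤ pk (suc n) (suc a)
    step n rec zero    = ≤-reflexive (trans (pk-1 n) (sym (pk-1 (suc n))))
    step n rec (suc a) = begin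
      pk n (suc (suc a))                                              ≡⟨ pk-rec n (suc a) ⟩
      pk n (suc a) + shift 0 (suc (suc a)) (λ m → pk m (suc (suc a))) n
        ≤⟨ +-mono-≤ (step n rec a) (shift-suc-mono (suc a) _ n (λ m m<n → rec m<n (suc a))) ⟩
      pk (suc n) (suc a) + shift 0 (suc (suc a)) (λ m → pk m (suc (suc a))) (suc n)
        ≡⟨ pk-rec (suc n) (suc a) ⟨
      pk (suc n) (suc (suc a))                                        ∎
      where open ≤-Reasoning

  p-mono : ∀ n → p n ≤ p (suc n)
  p-mono n = ≤-trans (≤-reflexive (sym (pk-suc-stable {n} ≤-refl))) (pk-mono n n)

  p-positive : ∀ n → 0 < p n
  p-positive zero    = s≤s z≤n
  p-positive (suc n) = pk-positive (suc n) n

  conv-mono : ∀ {m} j → j ≤ m → conv m j ≤ conv (suc m) j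
  conv-mono {m} zero _ = *-monoʳ-≤ 1 (p-mono m)
  conv-mono {m} (suc j) j<m = +-mono-≤
    (*-monoʳ-≤ (p (suc j)) (≤-trans (p-mono (m ∸ suc j)) (≤-reflexive (cong p (sym (+-∸-assoc 1 j<m))))))
    (conv-mono j (<⇒≤ j<m))

  pp-<-suc : ∀ m → pp m < pp (suc m)
  pp-<-suc m = +-mono-≤ p[1+m]*p0≥1 (conv-mono m ≤-refl)
    where
    p[1+m]*p0≥1 : 1 ≤ p (suc m) * p (m ∸ m)
    p[1+m]*p0≥1 rewrite n∸n≡0 m | *-identityʳ (p (suc m)) = p-positive (suc m)

  pp-positive : ∀ m → 0 < pp m
  pp-positive zero    = s≤s z≤n
  pp-positive (suc m) = <-trans (pp-positive m) (pp-<-suc m)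

  pp-mono : ∀ m d → pp m ≤ pp (d + m)
  pp-mono m zero    = ≤-refl
  pp-mono m (suc d) = ≤-trans (pp-mono m d) (<⇒≤ (pp-<-suc (d + m)))

  pp-strict : ∀ m d → pp m < pp (suc d + m)
  pp-strict m d = ≤-<-trans (pp-mono m d) (pp-<-suc (d + m))

  -- ppSub n m unfolds to shift 0 m pp n.
  ppSub-antitone : ∀ n {a b} → a ≤ b → ppSub n b ≤ ppSub n a
  ppSub-antitone n {a} {b} a≤b with offset b n
  ... | below n<b = ≤-trans (≤-reflexive (shift-below b pp n<b)) z≤n
  ... | above m refl = begin
    shift 0 b pp (b + m)                 ≡⟨ shift-above b pp m ⟩
    pp m                                 ≤⟨ pp-mono m (b ∸ a) ⟩
    pp (b ∸ a + m)                       ≡⟨ shift-above a pp (b ∸ a + m) ⟨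
    shift 0 a pp (a + (b ∸ a + m))       ≡⟨ cong (shift 0 a pp) a+[b∸a+m]≡b+m ⟩
    shift 0 a pp (b + m)                 ∎
    where
    open ≤-Reasoning
    a+[b∸a+m]≡b+m : a + (b ∸ a + m) ≡ b + m
    a+[b∸a+m]≡b+m = trans (sym (+-assoc a (b ∸ a) m)) (cong (_+ m) (m+[n∸m]≡n a≤b))

  ppSub-strict : ∀ {n a b} → a < b → a ≤ n → ppSub n b < ppSub n a
  ppSub-strict {n} {a} {b} a<b a≤n with offset b n | m≤n⇒∃[o]m+o≡n a≤n
  ... | below n<b | m , refl = begin-strict
    shift 0 b pp (a + m)  ≡⟨ shift-below b pp n<b ⟩
    0                     <⟨ pp-positive m ⟩
    pp m                  ≡⟨ shift-above a pp m ⟨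
    shift 0 a pp (a + m)  ∎
    where open ≤-Reasoning
  ... | above m refl | _ with m≤n⇒∃[o]m+o≡n a<b
  ...   | d , refl = begin-strict
    shift 0 (suc a + d) pp (suc a + d + m)  ≡⟨ shift-above (suc a + d) pp m ⟩
    pp m                                    <⟨ pp-strict m d ⟩
    pp (suc d + m)                          ≡⟨ shift-above a pp (suc d + m) ⟨
    shift 0 a pp (a + (suc d + m))          ≡⟨ cong (shift 0 a pp) a+[1+d+m]≡1+a+d+m ⟩
    shift 0 a pp (suc a + d + m)            ∎
    where
    open ≤-Reasoning
    a+[1+d+m]≡1+a+d+m : a + (suc d + m) ≡ suc a + d + m
    a+[1+d+m]≡1+a+d+m = trans (sym (+-assoc a (suc d) m)) (cong (_+ m) (+-suc a d))

  -- Partitions into even parts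

  -- The coefficients of f(q²).
  dilate : (ℕ → ℕ) → ℕ → ℕ
  dilate f zero          = f 0
  dilate f (suc zero)    = 0
  dilate f (suc (suc n)) = dilate (f ∘ suc) n

  dilate-cong : ∀ {f g} n → (∀ m → f m ≡ g m) → dilate f n ≡ dilate g n
  dilate-cong zero          f≡g = f≡g 0
  dilate-cong (suc zero)    f≡g = refl
  dilate-cong (suc (suc n)) f≡g = dilate-cong n (f≡g ∘ suc)

  dilate-+ : ∀ f g n → dilate (λ m → f m + g m) n ≡ dilate f n + dilate g n
  dilate-+ f g zero          = refl
  dilate-+ f g (suc zero)    = refl
  dilate-+ f g (suc (suc n)) = dilate-+ (f ∘ suc) (g ∘ suc) n

  dilate-zero : ∀ n → dilate (λ _ → 0) n ≡ 0
  dilate-zero zero          = refl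
  dilate-zero (suc zero)    = refl
  dilate-zero (suc (suc n)) = dilate-zero n

  dilate-odd : ∀ f m → dilate f (suc (m + m)) ≡ 0
  dilate-odd f zero    = refl
  dilate-odd f (suc m) rewrite +-suc m m = dilate-odd (f ∘ suc) m

  dilate-shift : ∀ s f n → dilate (shift 0 s f) n ≡ shift 0 (s + s) (dilate f) n
  dilate-shift zero    f n             = refl
  dilate-shift (suc s) f zero          = refl
  dilate-shift (suc s) f (suc zero)    =
    sym (shift-below (suc s + suc s) (dilate f) (s≤s (≤-trans (s≤s z≤n) (m≤n+m (suc s) s))))
  dilate-shift (suc s) f (suc (suc n)) rewrite +-suc s s = dilate-shift s f n

  pkEven : ℕ → ℕ → ℕ
  pkEven n k = dilate (λ m → pk m k) n

  pkEven-rec : ∀ n k → pkEven n (suc k) ≡ pkEven n k + shift 0 (suc k + suc k) (λ m → pkEven m (suc k)) n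
  pkEven-rec n k = begin
    pkEven n (suc k)                                                       ≡⟨ dilate-cong n (λ m → pk-rec m k) ⟩
    dilate (λ m → pk m k + shift 0 (suc k) (λ x → pk x (suc k)) m) n       ≡⟨ dilate-+ (λ m → pk m k) _ n ⟩
    pkEven n k + dilate (shift 0 (suc k) (λ x → pk x (suc k))) n           ≡⟨ cong (pkEven n k +_) (dilate-shift (suc k) _ n) ⟩
    pkEven n k + shift 0 (suc k + suc k) (λ m → pkEven m (suc k)) n        ∎
    where open ≡-Reasoning

  pkEven-zero : ∀ n → pkEven (suc n) 0 ≡ 0
  pkEven-zero zero    = refl
  pkEven-zero (suc n) = dilate-zero n

module PowerSeries where

  open Partitions
  open import Data.Nat as ℕ using (ℕ; zero; suc; _∸_; _≤_; _<_; z≤n; s≤s; ∣_-_∣)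
  import Data.Nat.Properties as ℕₚ
  open import Data.Integer using (ℤ; +_; -_; _+_; _*_; _-_)
  open import Data.Integer.Properties
  open import Data.Nat.Induction using (<-rec)
  open import Data.Nat.Divisibility using (_∣_; divides; _∣0; ∣-refl; ∣m∣n⇒∣m+n)
  open import Data.Product using (∃-syntax; _×_)
  open import Data.Sum using (_⊎_; inj₁; inj₂)
  open import Data.Empty using (⊥-elim)
  open import Relation.Nullary using (¬_)
  open import Data.Integer.Tactic.RingSolver using (solve-∀)
  open import Algebra.Properties.CommutativeSemigroup +-commutativeSemigroup using (interchange)
  import Algebra.Properties.CommutativeSemigroup ℕₚ.+-commutativeSemigroup as ℕ-Semigroup

  q^_·_ : ℕ → (ℕ → ℤ) → ℕ → ℤ
  q^ s · f = shift (+ 0) s f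

  ∑ : ℕ → (ℕ → ℤ) → ℤ
  ∑ zero    f = + 0
  ∑ (suc n) f = ∑ n f + f n

  ∑-cong : ∀ n {f g} → (∀ i → i < n → f i ≡ g i) → ∑ n f ≡ ∑ n g
  ∑-cong zero    f≡g = refl
  ∑-cong (suc n) f≡g = cong₂ _+_ (∑-cong n (λ i i<n → f≡g i (ℕₚ.m<n⇒m<1+n i<n))) (f≡g n ℕₚ.≤-refl)

  ∑-zero : ∀ n {f} → (∀ i → i < n → f i ≡ + 0) → ∑ n f ≡ + 0
  ∑-zero zero    f≡0 = refl
  ∑-zero (suc n) f≡0 = cong₂ _+_ (∑-zero n (λ i i<n → f≡0 i (ℕₚ.m<n⇒m<1+n i<n))) (f≡0 n ℕₚ.≤-refl)

  ∑-distrib-+ : ∀ n f g → ∑ n (λ i → f i + g i) ≡ ∑ n f + ∑ n g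
  ∑-distrib-+ zero    f g = refl
  ∑-distrib-+ (suc n) f g = trans (cong (_+ (f n + g n)) (∑-distrib-+ n f g)) (interchange (∑ n f) (∑ n g) (f n) (g n))

  ∑-split : ∀ a b f → ∑ (a ℕ.+ b) f ≡ ∑ a f + ∑ b (λ i → f (a ℕ.+ i))
  ∑-split a zero    f = trans (cong (λ t → ∑ t f) (ℕₚ.+-identityʳ a)) (sym (+-identityʳ _))
  ∑-split a (suc b) f = begin
    ∑ (a ℕ.+ suc b) f                                 ≡⟨ cong (λ t → ∑ t f) (ℕₚ.+-suc a b) ⟩
    ∑ (a ℕ.+ b) f + f (a ℕ.+ b)                       ≡⟨ cong (_+ f (a ℕ.+ b)) (∑-split a b f) ⟩
    ∑ a f + ∑ b (λ i → f (a ℕ.+ i)) + f (a ℕ.+ b)     ≡⟨ +-assoc (∑ a f) _ _ ⟩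
    ∑ a f + ∑ (suc b) (λ i → f (a ℕ.+ i))             ∎
    where open ≡-Reasoning

  ∑-head : ∀ n f → ∑ (suc n) f ≡ f 0 + ∑ n (f ∘ suc)
  ∑-head zero    f = +-comm (+ 0) (f 0)
  ∑-head (suc n) f = trans (cong (_+ f (suc n)) (∑-head n f)) (+-assoc (f 0) _ _)

  ∑-reverse : ∀ n f → ∑ (suc n) f ≡ ∑ (suc n) (λ i → f (n ∸ i))
  ∑-reverse zero    f = refl
  ∑-reverse (suc n) f = begin
    ∑ (suc n) f + f (suc n)                    ≡⟨ cong (_+ f (suc n)) (∑-reverse n f) ⟩
    ∑ (suc n) (λ i → f (n ∸ i)) + f (suc n)    ≡⟨ +-comm _ (f (suc n)) ⟩
    f (suc n) + ∑ (suc n) (λ i → f (n ∸ i))    ≡⟨ ∑-head (suc n) (λ i → f (suc n ∸ i)) ⟨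
    ∑ (suc (suc n)) (λ i → f (suc n ∸ i))      ∎
    where open ≡-Reasoning

  q^-∑ : ∀ s m (f : ℕ → ℕ → ℤ) n → (q^ s · (λ x → ∑ m (λ i → f i x))) n ≡ ∑ m (λ i → (q^ s · f i) n)
  q^-∑ s m f n with offset s n
  ... | below n<s =
    trans (shift-below s (λ x → ∑ m (λ i → f i x)) n<s) (sym (∑-zero m (λ i _ → shift-below s (f i) n<s)))
  ... | above r refl =
    trans (shift-above s (λ x → ∑ m (λ i → f i x)) r) (∑-cong m (λ i _ → sym (shift-above s (f i) r)))

  infixl 7 _⋆_
  _⋆_ : (ℕ → ℤ) → (ℕ → ℤ) → ℕ → ℤ
  (f ⋆ g) n = ∑ (suc n) (λ i → f i * g (n ∸ i))

  ⋆-comm : ∀ f g n → (f ⋆ g) n ≡ (g ⋆ f) n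
  ⋆-comm f g n = trans (∑-reverse n _) (∑-cong (suc n) (λ i i≤n →
    trans (cong (f (n ∸ i) *_) (cong g (ℕₚ.m∸[m∸n]≡n (ℕₚ.≤-pred i≤n)))) (*-comm (f (n ∸ i)) (g i))))

  ⋆-congˡ : ∀ {f f′} g n → (∀ m → f m ≡ f′ m) → (f ⋆ g) n ≡ (f′ ⋆ g) n
  ⋆-congˡ g n f≡f′ = ∑-cong (suc n) (λ i _ → cong (_* g (n ∸ i)) (f≡f′ i))

  ⋆-distribʳ-+ : ∀ f f′ g n → ((λ m → f m + f′ m) ⋆ g) n ≡ (f ⋆ g) n + (f′ ⋆ g) n
  ⋆-distribʳ-+ f f′ g n =
    trans (∑-cong (suc n) (λ i _ → *-distribʳ-+ (g (n ∸ i)) (f i) (f′ i))) (∑-distrib-+ (suc n) _ _)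

  q^-⋆ : ∀ s f g n → ((q^ s · f) ⋆ g) n ≡ (q^ s · (f ⋆ g)) n
  q^-⋆ s f g n with offset s n
  ... | below n<s = trans (∑-zero (suc n) term≡0) (sym (shift-below s (f ⋆ g) n<s))
    where
    term≡0 : ∀ i → i < suc n → (q^ s · f) i * g (n ∸ i) ≡ + 0
    term≡0 i i≤n = trans (cong (_* g (n ∸ i)) (shift-below s f (ℕₚ.<-≤-trans i≤n n<s))) (*-zeroˡ (g (n ∸ i)))
  ... | above m refl = begin
    ∑ (suc (s ℕ.+ m)) (λ i → (q^ s · f) i * g (s ℕ.+ m ∸ i))
      ≡⟨ cong (λ t → ∑ t (λ i → (q^ s · f) i * g (s ℕ.+ m ∸ i))) (sym (ℕₚ.+-suc s m)) ⟩
    ∑ (s ℕ.+ suc m) (λ i → (q^ s · f) i * g (s ℕ.+ m ∸ i))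
      ≡⟨ ∑-split s (suc m) _ ⟩
    ∑ s (λ i → (q^ s · f) i * g (s ℕ.+ m ∸ i))
      + ∑ (suc m) (λ i → (q^ s · f) (s ℕ.+ i) * g (s ℕ.+ m ∸ (s ℕ.+ i)))
      ≡⟨ cong₂ _+_ (∑-zero s head≡0) (∑-cong (suc m) (λ i _ →
           cong₂ _*_ (shift-above s f i) (cong g (ℕₚ.[m+n]∸[m+o]≡n∸o s m i)))) ⟩
    + 0 + (f ⋆ g) m
      ≡⟨ +-identityˡ _ ⟩
    (f ⋆ g) m
      ≡⟨ shift-above s (f ⋆ g) m ⟨
    (q^ s · (f ⋆ g)) (s ℕ.+ m)
      ∎
    where
    open ≡-Reasoning
    head≡0 : ∀ i → i < s → (q^ s · f) i * g (s ℕ.+ m ∸ i) ≡ + 0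
    head≡0 i i<s = trans (cong (_* g (s ℕ.+ m ∸ i)) (shift-below s f i<s)) (*-zeroˡ (g (s ℕ.+ m ∸ i)))

  pkℤ : ℕ → ℕ → ℤ
  pkℤ a m = + pk m a

  pkℤ-rec : ∀ a m → pkℤ (suc a) m ≡ pkℤ a m + (q^ suc a · pkℤ (suc a)) m
  pkℤ-rec a m = begin
    + pk m (suc a)
      ≡⟨ cong +_ (pk-rec m a) ⟩
    + (pk m a ℕ.+ shift 0 (suc a) (λ x → pk x (suc a)) m)
      ≡⟨ pos-+ (pk m a) _ ⟩
    + pk m a + + shift 0 (suc a) (λ x → pk x (suc a)) m
      ≡⟨ cong (_+_ (pkℤ a m)) (shift-map +_ refl (suc a) (λ x → pk x (suc a)) m) ⟨
    pkℤ a m + (q^ suc a · pkℤ (suc a)) m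
      ∎
    where open ≡-Reasoning

  ppk : ℕ → ℕ → ℕ → ℤ
  ppk a b = pkℤ a ⋆ pkℤ b

  ppk-recˡ : ∀ a b n → ppk (suc a) b n ≡ ppk a b n + (q^ suc a · ppk (suc a) b) n
  ppk-recˡ a b n = begin
    (pkℤ (suc a) ⋆ pkℤ b) n
      ≡⟨ ⋆-congˡ (pkℤ b) n (pkℤ-rec a) ⟩
    ((λ m → pkℤ a m + (q^ suc a · pkℤ (suc a)) m) ⋆ pkℤ b) n
      ≡⟨ ⋆-distribʳ-+ (pkℤ a) (q^ suc a · pkℤ (suc a)) (pkℤ b) n ⟩
    ppk a b n + ((q^ suc a · pkℤ (suc a)) ⋆ pkℤ b) n
      ≡⟨ cong (_+_ (ppk a b n)) (q^-⋆ (suc a) (pkℤ (suc a)) (pkℤ b) n) ⟩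
    ppk a b n + (q^ suc a · ppk (suc a) b) n
      ∎
    where open ≡-Reasoning

  ppk-recʳ : ∀ a b n → ppk a (suc b) n ≡ ppk a b n + (q^ suc b · ppk a (suc b)) n
  ppk-recʳ a b n = begin
    ppk a (suc b) n                          ≡⟨ ⋆-comm (pkℤ a) (pkℤ (suc b)) n ⟩
    ppk (suc b) a n                          ≡⟨ ppk-recˡ b a n ⟩
    ppk b a n + (q^ suc b · ppk (suc b) a) n ≡⟨ cong₂ _+_ (⋆-comm (pkℤ b) (pkℤ a) n)
                                                  (shift-cong (suc b) n (λ m _ → ⋆-comm (pkℤ (suc b)) (pkℤ a) m)) ⟩
    ppk a b n + (q^ suc b · ppk a (suc b)) n ∎
    where open ≡-Reasoning

  ppk-rec² : ∀ a b n → ppk (suc a) (suc b) n ≡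
    ppk a (suc b) n + (q^ suc a · ppk (suc a) b) n + (q^ (suc a ℕ.+ suc b) · ppk (suc a) (suc b)) n
  ppk-rec² a b n = begin
    ppk (suc a) (suc b) n
      ≡⟨ ppk-recˡ a (suc b) n ⟩
    ppk a (suc b) n + (q^ suc a · ppk (suc a) (suc b)) n
      ≡⟨ cong (_+_ (ppk a (suc b) n)) (shift-cong (suc a) n (λ m _ → ppk-recʳ (suc a) b m)) ⟩
    ppk a (suc b) n + (q^ suc a · (λ m → ppk (suc a) b m + (q^ suc b · ppk (suc a) (suc b)) m)) n
      ≡⟨ cong (_+_ (ppk a (suc b) n)) (shift-zipWith _+_ refl (suc a) (ppk (suc a) b) (q^ suc b · ppk (suc a) (suc b)) n) ⟩
    ppk a (suc b) n + ((q^ suc a · ppk (suc a) b) n + (q^ suc a · (q^ suc b · ppk (suc a) (suc b))) n)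
      ≡⟨ cong (λ t → ppk a (suc b) n + ((q^ suc a · ppk (suc a) b) n + t))
              (shift-shift (suc a) (suc b) (ppk (suc a) (suc b)) n) ⟩
    ppk a (suc b) n + ((q^ suc a · ppk (suc a) b) n + (q^ (suc a ℕ.+ suc b) · ppk (suc a) (suc b)) n)
      ≡⟨ +-assoc (ppk a (suc b) n) _ _ ⟨
    ppk a (suc b) n + (q^ suc a · ppk (suc a) b) n + (q^ (suc a ℕ.+ suc b) · ppk (suc a) (suc b)) n
      ∎
    where open ≡-Reasoning

  -- The truncated theta quotients

  infix 8 _²
  _² : ℕ → ℕ
  d ² = d ℕ.* d

  +∣-∣² : ∀ a b → + (∣ a - b ∣ ²) ≡ (+ a - + b) * (+ a - + b)
  +∣-∣² zero    b       = trans (pos-* b b) (trans (sym (neg*neg (+ b))) (cong (λ t → t * t) (sym (+-identityˡ (- + b)))))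
    where
    neg*neg : ∀ x → (- x) * (- x) ≡ x * x
    neg*neg = solve-∀
  +∣-∣² (suc a) zero    = trans (pos-* (suc a) (suc a)) (cong (λ t → t * t) (sym (+-identityʳ (+ suc a))))
  +∣-∣² (suc a) (suc b) = trans (+∣-∣² a b) (cong (λ t → t * t) (trans (m-n≡m⊖n a b)
    (sym (trans (m-n≡m⊖n (suc a) (suc b)) ([1+m]⊖[1+n]≡m⊖n a b)))))

  +-∸ : ∀ {m n} → n ≤ m → + (m ∸ n) ≡ + m - + n
  +-∸ {m} {n} n≤m = sym (trans (m-n≡m⊖n m n) (⊖-≥ n≤m))

  ∣-∣²-offset : ∀ k m → m ≤ suc (k ℕ.+ k) →
    ∣ m - k ∣ ² ℕ.+ (suc (k ℕ.+ k) ∸ m) ≡ ∣ m - suc k ∣ ² ℕ.+ m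
  ∣-∣²-offset k m m≤2k+1 = +-injective (begin
    + (∣ m - k ∣ ² ℕ.+ (suc (k ℕ.+ k) ∸ m))
      ≡⟨ pos-+ (∣ m - k ∣ ²) _ ⟩
    + (∣ m - k ∣ ²) + + (suc (k ℕ.+ k) ∸ m)
      ≡⟨ cong₂ _+_ (+∣-∣² m k) (trans (+-∸ m≤2k+1) (cong (_- + m) (pos-+ 1 (k ℕ.+ k)))) ⟩
    (+ m - + k) * (+ m - + k) + (+ 1 + + (k ℕ.+ k) - + m)
      ≡⟨ cong (λ t → (+ m - + k) * (+ m - + k) + (+ 1 + t - + m)) (pos-+ k k) ⟩
    (+ m - + k) * (+ m - + k) + (+ 1 + (+ k + + k) - + m)
      ≡⟨ square-shift (+ m) (+ k) ⟩
    (+ m - (+ 1 + + k)) * (+ m - (+ 1 + + k)) + + m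
      ≡⟨ cong (_+ + m) (+∣-∣² m (suc k)) ⟨
    + (∣ m - suc k ∣ ²) + + m
      ≡⟨ pos-+ (∣ m - suc k ∣ ²) m ⟨
    + (∣ m - suc k ∣ ² ℕ.+ m)
      ∎)
    where
    open ≡-Reasoning
    square-shift : ∀ x y → (x - y) * (x - y) + (+ 1 + (y + y) - x) ≡ (x - (+ 1 + y)) * (x - (+ 1 + y)) + x
    square-shift = solve-∀

  q^-peel : ∀ σ e s {G A : ℕ → ℤ} n → (∀ x → G x ≡ A x + (q^ s · G) x) →
    σ * (q^ e · G) n ≡ σ * (q^ e · A) n + (q^ s · (λ x → σ * (q^ e · G) x)) n
  q^-peel σ e s {G} {A} n G≡A+q^sG = begin
    σ * (q^ e · G) n
      ≡⟨ cong (σ *_) (shift-cong e n (λ x _ → G≡A+q^sG x)) ⟩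
    σ * (q^ e · (λ x → A x + (q^ s · G) x)) n
      ≡⟨ cong (σ *_) (shift-zipWith _+_ refl e A (q^ s · G) n) ⟩
    σ * ((q^ e · A) n + (q^ e · (q^ s · G)) n)
      ≡⟨ *-distribˡ-+ σ _ _ ⟩
    σ * (q^ e · A) n + σ * (q^ e · (q^ s · G)) n
      ≡⟨ cong (λ t → σ * (q^ e · A) n + σ * t) q^eq^s≡q^sq^e ⟩
    σ * (q^ e · A) n + σ * (q^ s · (q^ e · G)) n
      ≡⟨ cong (_+_ (σ * (q^ e · A) n)) (shift-map (σ *_) (*-zeroʳ σ) s (q^ e · G) n) ⟨
    σ * (q^ e · A) n + (q^ s · (λ x → σ * (q^ e · G) x)) n
      ∎
    where
    open ≡-Reasoning
    q^eq^s≡q^sq^e : (q^ e · (q^ s · G)) n ≡ (q^ s · (q^ e · G)) n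
    q^eq^s≡q^sq^e = trans (shift-shift e s G n)
      (trans (cong (λ t → shift (+ 0) t G n) (ℕₚ.+-comm e s)) (sym (shift-shift s e G n)))

  ∑-regroup : ∀ n {T S a b : ℕ → ℤ} → T 0 ≡ b 0 + S 0 →
    (∀ i → i < n → T (suc i) ≡ a i + b (suc i) + S (suc i)) →
    ∑ (suc n) T ≡ ∑ n a + ∑ (suc n) b + ∑ (suc n) S
  ∑-regroup zero {T} {S} {a} {b} T₀ _ = trans (cong (_+_ (+ 0)) T₀) (shuffle (b 0) (S 0))
    where
    shuffle : ∀ x y → + 0 + (x + y) ≡ + 0 + (+ 0 + x) + (+ 0 + y)
    shuffle = solve-∀
  ∑-regroup (suc n) {T} {S} {a} {b} T₀ Tₛ =
    trans (cong₂ _+_ (∑-regroup n T₀ (λ i i<n → Tₛ i (ℕₚ.m<n⇒m<1+n i<n))) (Tₛ n ℕₚ.≤-refl))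
          (shuffle (∑ n a) (∑ (suc n) b) (∑ (suc n) S) (a n) (b (suc n)) (S (suc n)))
    where
    shuffle : ∀ A B C x y z → A + B + C + (x + y + z) ≡ A + x + (B + y) + (C + z)
    shuffle = solve-∀

  θ-term : ℕ → ℕ → ℕ → ℕ → ℤ
  θ-term k N i n = sgn (i ℕ.+ k) * (q^ ∣ i - k ∣ ² · ppk i (N ∸ i)) n

  θ : ℕ → ℕ → ℤ
  θ k n = ∑ (suc (k ℕ.+ k)) (λ i → θ-term k (k ℕ.+ k) i n)

  -- The summand T i of θ (k + 1) is a (i - 1) + b i (dropping whichever is out of range) plus
  -- q^N₂ times itself, and a m + b m is the m-th summand of θ k for m ≤ 2k and vanishes for m = 2k + 1.
  module θ-Step (k n : ℕ) where

    N N₂ : ℕ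
    N  = k ℕ.+ k
    N₂ = suc (suc N)

    σ : ℕ → ℤ
    σ i = sgn (i ℕ.+ suc k)

    e : ℕ → ℕ
    e i = ∣ i - suc k ∣ ²

    G U W : ℕ → ℕ → ℤ
    G i = ppk i (N₂ ∸ i)
    U m = ppk m (suc N ∸ m)
    W m = ppk m (N ∸ m)

    T S a b : ℕ → ℤ
    T i = θ-term (suc k) N₂ i n
    S i = (q^ N₂ · θ-term (suc k) N₂ i) n
    a m = σ (suc m) * (q^ e (suc m) · U m) n
    b m = σ m * (q^ (e m ℕ.+ m) · U m) n

    1+N∸m≡1+[N∸m] : ∀ {m} → m ≤ N → suc N ∸ m ≡ suc (N ∸ m)
    1+N∸m≡1+[N∸m] m≤N = ℕₚ.+-∸-assoc 1 m≤N

    1+m+[1+N∸m]≡N₂ : ∀ {m} → m ≤ N → suc m ℕ.+ suc (N ∸ m) ≡ N₂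
    1+m+[1+N∸m]≡N₂ {m} m≤N = cong suc (trans (ℕₚ.+-suc m (N ∸ m)) (cong suc (ℕₚ.m+[n∸m]≡n m≤N)))

    G-suc : ∀ {m} → m ≤ N → ∀ x → G (suc m) x ≡ U m x + (q^ suc m · U (suc m)) x + (q^ N₂ · G (suc m)) x
    G-suc {m} m≤N x rewrite 1+N∸m≡1+[N∸m] m≤N | sym (1+m+[1+N∸m]≡N₂ m≤N) = ppk-rec² m (N ∸ m) x

    G-last : ∀ x → G N₂ x ≡ U (suc N) x + (q^ N₂ · G N₂) x
    G-last x rewrite ℕₚ.n∸n≡0 N = ppk-recˡ (suc N) 0 x

    U-rec : ∀ {m} → m ≤ N → ∀ x → U m x ≡ W m x + (q^ (suc N ∸ m) · U m) x
    U-rec {m} m≤N x rewrite 1+N∸m≡1+[N∸m] m≤N = ppk-recʳ m (N ∸ m) x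

    T-zero : T 0 ≡ b 0 + S 0
    T-zero = trans (q^-peel (σ 0) (e 0) N₂ {A = U 0} n (ppk-recʳ 0 (suc N)))
      (cong (λ t → σ 0 * (q^ t · U 0) n + S 0) (sym (ℕₚ.+-identityʳ (e 0))))

    T-suc : ∀ {m} → m ≤ N → T (suc m) ≡ a m + b (suc m) + S (suc m)
    T-suc {m} m≤N = trans (q^-peel (σ (suc m)) (e (suc m)) N₂ {A = λ x → U m x + (q^ suc m · U (suc m)) x} n (G-suc m≤N))
      (cong (_+ S (suc m)) (begin
        σ (suc m) * (q^ e (suc m) · (λ x → U m x + (q^ suc m · U (suc m)) x)) n
          ≡⟨ cong (σ (suc m) *_) (shift-zipWith _+_ refl (e (suc m)) (U m) (q^ suc m · U (suc m)) n) ⟩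
        σ (suc m) * ((q^ e (suc m) · U m) n + (q^ e (suc m) · (q^ suc m · U (suc m))) n)
          ≡⟨ cong (λ t → σ (suc m) * ((q^ e (suc m) · U m) n + t)) (shift-shift (e (suc m)) (suc m) (U (suc m)) n) ⟩
        σ (suc m) * ((q^ e (suc m) · U m) n + (q^ (e (suc m) ℕ.+ suc m) · U (suc m)) n)
          ≡⟨ *-distribˡ-+ (σ (suc m)) _ _ ⟩
        a m + b (suc m)
          ∎))
      where open ≡-Reasoning

    T-last : T N₂ ≡ a (suc N) + S N₂
    T-last = q^-peel (σ N₂) (e N₂) N₂ {A = U (suc N)} n G-last

    σ≡-sgn : ∀ m → σ m ≡ - sgn (m ℕ.+ k)
    σ≡-sgn m = cong sgn (ℕₚ.+-suc m k)

    a+b≡θ-term : ∀ {m} → m ≤ N → a m + b m ≡ θ-term k N m n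
    a+b≡θ-term {m} m≤N = begin
      - σ m * (q^ ∣ m - k ∣ ² · U m) n + b m
        ≡⟨ cong (λ t → - σ m * t + b m) q^U≡q^W+q^U ⟩
      - σ m * ((q^ ∣ m - k ∣ ² · W m) n + (q^ (e m ℕ.+ m) · U m) n) + σ m * (q^ (e m ℕ.+ m) · U m) n
        ≡⟨ cancel (σ m) _ _ ⟩
      - σ m * (q^ ∣ m - k ∣ ² · W m) n
        ≡⟨ cong (λ t → - t * (q^ ∣ m - k ∣ ² · W m) n) (σ≡-sgn m) ⟩
      - - sgn (m ℕ.+ k) * (q^ ∣ m - k ∣ ² · W m) n
        ≡⟨ cong (_* (q^ ∣ m - k ∣ ² · W m) n) (neg-involutive (sgn (m ℕ.+ k))) ⟩
      θ-term k N m n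
        ∎
      where
      open ≡-Reasoning
      cancel : ∀ s x y → - s * (x + y) + s * y ≡ - s * x
      cancel = solve-∀
      q^U≡q^W+q^U : (q^ ∣ m - k ∣ ² · U m) n ≡ (q^ ∣ m - k ∣ ² · W m) n + (q^ (e m ℕ.+ m) · U m) n
      q^U≡q^W+q^U = begin
        (q^ ∣ m - k ∣ ² · U m) n
          ≡⟨ shift-cong (∣ m - k ∣ ²) n (λ x _ → U-rec m≤N x) ⟩
        (q^ ∣ m - k ∣ ² · (λ x → W m x + (q^ (suc N ∸ m) · U m) x)) n
          ≡⟨ shift-zipWith _+_ refl (∣ m - k ∣ ²) (W m) (q^ (suc N ∸ m) · U m) n ⟩
        (q^ ∣ m - k ∣ ² · W m) n + (q^ ∣ m - k ∣ ² · (q^ (suc N ∸ m) · U m)) n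
          ≡⟨ cong (_+_ ((q^ ∣ m - k ∣ ² · W m) n)) (shift-shift (∣ m - k ∣ ²) (suc N ∸ m) (U m) n) ⟩
        (q^ ∣ m - k ∣ ² · W m) n + (q^ (∣ m - k ∣ ² ℕ.+ (suc N ∸ m)) · U m) n
          ≡⟨ cong (λ t → (q^ ∣ m - k ∣ ² · W m) n + (q^ t · U m) n)
                  (∣-∣²-offset k m (ℕₚ.m≤n⇒m≤1+n m≤N)) ⟩
        (q^ ∣ m - k ∣ ² · W m) n + (q^ (e m ℕ.+ m) · U m) n
          ∎

    a+b-last : a (suc N) + b (suc N) ≡ + 0
    a+b-last = begin
      - σ (suc N) * (q^ e N₂ · U (suc N)) n + b (suc N)
        ≡⟨ cong (λ t → - σ (suc N) * (q^ t · U (suc N)) n + b (suc N)) e[N₂]≡e[N+1]+N+1 ⟩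
      - σ (suc N) * (q^ (e (suc N) ℕ.+ suc N) · U (suc N)) n + σ (suc N) * (q^ (e (suc N) ℕ.+ suc N) · U (suc N)) n
        ≡⟨ cancel (σ (suc N)) _ ⟩
      + 0
        ∎
      where
      open ≡-Reasoning
      cancel : ∀ s x → - s * x + s * x ≡ + 0
      cancel = solve-∀
      e[N₂]≡e[N+1]+N+1 : e N₂ ≡ e (suc N) ℕ.+ suc N
      e[N₂]≡e[N+1]+N+1 = begin
        ∣ suc N - k ∣ ²                        ≡⟨ ℕₚ.+-identityʳ _ ⟨
        ∣ suc N - k ∣ ² ℕ.+ 0                  ≡⟨ cong (∣ suc N - k ∣ ² ℕ.+_) (ℕₚ.n∸n≡0 N) ⟨
        ∣ suc N - k ∣ ² ℕ.+ (suc N ∸ suc N)    ≡⟨ ∣-∣²-offset k (suc N) ℕₚ.≤-refl ⟩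
        e (suc N) ℕ.+ suc N                    ∎

    ∑T≡θ+q^∑T : ∑ (suc N₂) T ≡ θ k n + (q^ N₂ · (λ x → ∑ (suc N₂) (λ i → θ-term (suc k) N₂ i x))) n
    ∑T≡θ+q^∑T = begin
      ∑ N₂ T + T N₂
        ≡⟨ cong₂ _+_ (∑-regroup (suc N) T-zero (λ i i≤N → T-suc (ℕₚ.≤-pred i≤N))) T-last ⟩
      ∑ (suc N) a + ∑ N₂ b + ∑ N₂ S + (a (suc N) + S N₂)
        ≡⟨ shuffle (∑ (suc N) a) (∑ N₂ b) (∑ N₂ S) (a (suc N)) (S N₂) ⟩
      ∑ N₂ a + ∑ N₂ b + ∑ (suc N₂) S
        ≡⟨ cong (_+ ∑ (suc N₂) S) (∑-distrib-+ N₂ a b) ⟨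
      ∑ (suc N) (λ m → a m + b m) + (a (suc N) + b (suc N)) + ∑ (suc N₂) S
        ≡⟨ cong₂ (λ x y → x + y + ∑ (suc N₂) S)
                 (∑-cong (suc N) (λ m m≤N → a+b≡θ-term (ℕₚ.≤-pred m≤N))) a+b-last ⟩
      θ k n + + 0 + ∑ (suc N₂) S
        ≡⟨ cong₂ _+_ (+-identityʳ (θ k n)) (sym (q^-∑ N₂ (suc N₂) (θ-term (suc k) N₂) n)) ⟩
      θ k n + (q^ N₂ · (λ x → ∑ (suc N₂) (λ i → θ-term (suc k) N₂ i x))) n
        ∎
      where
      open ≡-Reasoning
      shuffle : ∀ A B C x y → A + B + C + (x + y) ≡ A + x + B + (C + y)
      shuffle = solve-∀

  θ-rec : ∀ k n → θ (suc k) n ≡ θ k n + (q^ (suc k ℕ.+ suc k) · θ (suc k)) n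
  θ-rec k n = begin
    θ (suc k) n
      ≡⟨ θ≡∑T n ⟩
    ∑ (suc N₂) (λ i → θ-term (suc k) N₂ i n)
      ≡⟨ ∑T≡θ+q^∑T ⟩
    θ k n + (q^ N₂ · (λ x → ∑ (suc N₂) (λ i → θ-term (suc k) N₂ i x))) n
      ≡⟨ cong (_+_ (θ k n)) (shift-cong N₂ n (λ x _ → sym (θ≡∑T x))) ⟩
    θ k n + (q^ N₂ · θ (suc k)) n
      ≡⟨ cong (λ t → θ k n + (q^ t · θ (suc k)) n) 2[k+1]≡N₂ ⟨
    θ k n + (q^ (suc k ℕ.+ suc k) · θ (suc k)) n
      ∎
    where
    open ≡-Reasoning
    open θ-Step k n using (N₂; ∑T≡θ+q^∑T)
    2[k+1]≡N₂ : suc k ℕ.+ suc k ≡ N₂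
    2[k+1]≡N₂ = cong suc (ℕₚ.+-suc k k)
    θ≡∑T : ∀ x → θ (suc k) x ≡ ∑ (suc N₂) (λ i → θ-term (suc k) N₂ i x)
    θ≡∑T x = cong (λ M → ∑ (suc M) (λ i → θ-term (suc k) M i x)) 2[k+1]≡N₂

  q^-fixpoint-unique : ∀ s → 0 < s → ∀ {g f h : ℕ → ℤ} →
    (∀ n → f n ≡ g n + (q^ s · f) n) → (∀ n → h n ≡ g n + (q^ s · h) n) → ∀ n → f n ≡ h n
  q^-fixpoint-unique s 0<s {g} {f} {h} f-rec h-rec = <-rec (λ n → f n ≡ h n) step
    where
    step : ∀ n → (∀ {m} → m < n → f m ≡ h m) → f n ≡ h n
    step n rec = begin
      f n                  ≡⟨ f-rec n ⟩
      g n + (q^ s · f) n   ≡⟨ cong (_+_ (g n)) (shift-cong s n (λ m n≡s+m → rec (m<n n≡s+m))) ⟩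
      g n + (q^ s · h) n   ≡⟨ h-rec n ⟨
      h n                  ∎
      where
      open ≡-Reasoning
      m<n : ∀ {m} → n ≡ s ℕ.+ m → m < n
      m<n {m} refl = ℕₚ.m<n+m m 0<s

  θ-zero : ∀ n → θ 0 n ≡ + pkEven n 0
  θ-zero zero    = refl
  θ-zero (suc n) = trans (+-identityˡ _) (trans (*-identityˡ _) (trans ppk00≡0 (cong +_ (sym (pkEven-zero n)))))
    where
    ppk00≡0 : ppk 0 0 (suc n) ≡ + 0
    ppk00≡0 = ∑-zero (suc (suc n)) λ where
      zero    _ → refl
      (suc i) _ → *-zeroˡ (pkℤ 0 (n ∸ i))

  θ-closed-form : ∀ k n → θ k n ≡ + pkEven n k
  θ-closed-form zero    = θ-zero
  θ-closed-form (suc k) = q^-fixpoint-unique (suc k ℕ.+ suc k) (s≤s z≤n) {g = θ k} (θ-rec k) pkEven-rec′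
    where
    pkEven-rec′ : ∀ n → + pkEven n (suc k) ≡ θ k n + (q^ (suc k ℕ.+ suc k) · (λ x → + pkEven x (suc k))) n
    pkEven-rec′ n = begin
      + pkEven n (suc k)
        ≡⟨ cong +_ (pkEven-rec n k) ⟩
      + (pkEven n k ℕ.+ shift 0 (suc k ℕ.+ suc k) (λ m → pkEven m (suc k)) n)
        ≡⟨ pos-+ (pkEven n k) _ ⟩
      + pkEven n k + + shift 0 (suc k ℕ.+ suc k) (λ m → pkEven m (suc k)) n
        ≡⟨ cong₂ _+_ (θ-closed-form k n) (shift-map +_ refl (suc k ℕ.+ suc k) (λ m → pkEven m (suc k)) n) ⟨
      θ k n + (q^ (suc k ℕ.+ suc k) · (λ x → + pkEven x (suc k))) n
        ∎
      where open ≡-Reasoning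

  -- θ K for large K

  conv-∑ : ∀ n j → + conv n j ≡ ∑ (suc j) (λ i → + p i * + p (n ∸ i))
  conv-∑ n zero    = trans (pos-* (p 0) (p n)) (sym (+-identityˡ _))
  conv-∑ n (suc j) = begin
    + (p (suc j) ℕ.* p (n ∸ suc j) ℕ.+ conv n j)              ≡⟨ pos-+ (p (suc j) ℕ.* p (n ∸ suc j)) _ ⟩
    + (p (suc j) ℕ.* p (n ∸ suc j)) + + conv n j              ≡⟨ +-comm (+ _) (+ conv n j) ⟩
    + conv n j + + (p (suc j) ℕ.* p (n ∸ suc j))              ≡⟨ cong₂ _+_ (conv-∑ n j) (pos-* (p (suc j)) _) ⟩
    ∑ (suc (suc j)) (λ i → + p i * + p (n ∸ i))               ∎
    where open ≡-Reasoning

  ppk-stable : ∀ {a b m} → m ≤ a → m ≤ b → ppk a b m ≡ + pp m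
  ppk-stable {a} {b} {m} m≤a m≤b = trans
    (∑-cong (suc m) (λ i i≤m → cong₂ (λ x y → + x * + y)
      (pk-stable (ℕₚ.≤-trans (ℕₚ.≤-pred i≤m) m≤a)) (pk-stable (ℕₚ.≤-trans (ℕₚ.m∸n≤m m i) m≤b))))
    (sym (conv-∑ m m))

  signedPpSub : ℕ → ℕ → ℤ
  signedPpSub n d = sgn d * + ppSub n (d ²)

  altSum≡∑ : ∀ n K → altSum n K ≡ ∑ K (λ t → signedPpSub n (suc t))
  altSum≡∑ n zero    = refl
  altSum≡∑ n (suc K) = cong (_+ signedPpSub n (suc K)) (altSum≡∑ n K)

  sgn-∣-∣ : ∀ i k → sgn (i ℕ.+ k) ≡ sgn ∣ i - k ∣
  sgn-∣-∣ zero    k       = refl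
  sgn-∣-∣ (suc i) zero    = cong sgn (ℕₚ.+-identityʳ (suc i))
  sgn-∣-∣ (suc i) (suc k) = trans (cong (-_ ∘ sgn) (ℕₚ.+-suc i k)) (trans (neg-involutive _) (sgn-∣-∣ i k))

  d≤d² : ∀ d → d ≤ d ²
  d≤d² zero    = z≤n
  d≤d² (suc d) = ℕₚ.m≤m*n (suc d) (suc d)

  θ-term-stable : ∀ {K n} → n ℕ.+ n ≤ K → ∀ i → θ-term K (K ℕ.+ K) i n ≡ signedPpSub n ∣ i - K ∣
  θ-term-stable {K} {n} 2n≤K i = cong₂ _*_ (sgn-∣-∣ i K) (trans
    (shift-cong (d ²) n (λ m n≡d²+m → ppk-stable (m≤i n≡d²+m) (m≤2K∸i n≡d²+m)))
    (shift-map +_ refl (d ²) pp n))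
    where
    d = ∣ i - K ∣
    m+d≤K : ∀ {m} → n ≡ d ² ℕ.+ m → m ℕ.+ d ≤ K
    m+d≤K {m} refl = ℕₚ.≤-trans
      (ℕₚ.+-mono-≤ (ℕₚ.m≤n+m m (d ²)) (ℕₚ.≤-trans (d≤d² d) (ℕₚ.m≤m+n (d ²) m))) 2n≤K
    m≤i : ∀ {m} → n ≡ d ² ℕ.+ m → m ≤ i
    m≤i {m} eq = ℕₚ.+-cancelʳ-≤ d m i (ℕₚ.≤-trans (m+d≤K eq) (ℕₚ.m≤n+∣n-m∣ K i))
    m≤2K∸i : ∀ {m} → n ≡ d ² ℕ.+ m → m ≤ K ℕ.+ K ∸ i
    m≤2K∸i {m} eq = ℕₚ.m+n≤o⇒m≤o∸n m (begin
      m ℕ.+ i          ≤⟨ ℕₚ.+-monoʳ-≤ m (ℕₚ.m≤n+∣m-n∣ i K) ⟩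
      m ℕ.+ (K ℕ.+ d)  ≡⟨ ℕ-Semigroup.x∙yz≈y∙xz m K d ⟩
      K ℕ.+ (m ℕ.+ d)  ≤⟨ ℕₚ.+-monoʳ-≤ K (m+d≤K eq) ⟩
      K ℕ.+ K          ∎)
      where open ℕₚ.≤-Reasoning

  ∑-symmetric : ∀ (φ : ℕ → ℤ) K → ∑ (suc (K ℕ.+ K)) (λ i → φ ∣ i - K ∣) ≡ φ 0 + + 2 * ∑ K (φ ∘ suc)
  ∑-symmetric φ zero    = trans (+-identityˡ (φ 0)) (sym (+-identityʳ (φ 0)))
  ∑-symmetric φ (suc K) = begin
    ∑ (suc (suc K ℕ.+ suc K)) f
      ≡⟨ cong (λ t → ∑ (suc (suc t)) f) (ℕₚ.+-suc K K) ⟩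
    ∑ (suc (suc (K ℕ.+ K))) f + f (suc (suc (K ℕ.+ K)))
      ≡⟨ cong₂ _+_ (∑-head (suc (K ℕ.+ K)) f) (cong φ ∣2K+1-K∣≡K+1) ⟩
    φ (suc K) + ∑ (suc (K ℕ.+ K)) (λ i → φ ∣ i - K ∣) + φ (suc K)
      ≡⟨ cong (λ t → φ (suc K) + t + φ (suc K)) (∑-symmetric φ K) ⟩
    φ (suc K) + (φ 0 + + 2 * ∑ K (φ ∘ suc)) + φ (suc K)
      ≡⟨ collect (φ (suc K)) (φ 0) (∑ K (φ ∘ suc)) ⟩
    φ 0 + + 2 * ∑ (suc K) (φ ∘ suc)
      ∎
    where
    open ≡-Reasoning
    f : ℕ → ℤ
    f i = φ ∣ i - suc K ∣
    ∣2K+1-K∣≡K+1 : ∣ suc (K ℕ.+ K) - K ∣ ≡ suc K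
    ∣2K+1-K∣≡K+1 = trans (ℕₚ.m≤n⇒∣n-m∣≡n∸m (ℕₚ.m≤n+m K (suc K))) (ℕₚ.m+n∸n≡m (suc K) K)
    collect : ∀ x y s → x + (y + + 2 * s) + x ≡ y + + 2 * (s + x)
    collect = solve-∀

  θ-stable : ∀ {K n} → n ℕ.+ n ≤ K → θ K n ≡ + pp n + + 2 * altSum n K
  θ-stable {K} {n} 2n≤K = begin
    θ K n
      ≡⟨ ∑-cong (suc (K ℕ.+ K)) (λ i _ → θ-term-stable 2n≤K i) ⟩
    ∑ (suc (K ℕ.+ K)) (λ i → signedPpSub n ∣ i - K ∣)
      ≡⟨ ∑-symmetric (signedPpSub n) K ⟩
    + 1 * + pp n + + 2 * ∑ K (λ t → signedPpSub n (suc t))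
      ≡⟨ cong₂ (λ x y → x + + 2 * y) (*-identityˡ (+ pp n)) (sym (altSum≡∑ n K)) ⟩
    + pp n + + 2 * altSum n K
      ∎
    where open ≡-Reasoning

  -- Signs and the alternating tail

  sgn-+ : ∀ x y → sgn (x ℕ.+ y) ≡ sgn x * sgn y
  sgn-+ zero    y = sym (*-identityˡ (sgn y))
  sgn-+ (suc x) y = trans (cong -_ (sgn-+ x y)) (neg-distribˡ-* (sgn x) (sgn y))

  sgn-square : ∀ x → sgn x * sgn x ≡ + 1
  sgn-square zero    = refl
  sgn-square (suc x) = trans (neg*neg (sgn x)) (sgn-square x)
    where
    neg*neg : ∀ s → - s * - s ≡ s * s
    neg*neg = solve-∀

  sgn-even : ∀ {ν} → 2 ∣ ν → sgn ν ≡ + 1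
  sgn-even (divides q refl) =
    trans (cong sgn (trans (ℕₚ.*-comm q 2) (cong (q ℕ.+_) (ℕₚ.+-identityʳ q)))) (trans (sgn-+ q q) (sgn-square q))

  ¬2∣⇒odd : ∀ n → ¬ 2 ∣ n → ∃[ m ] n ≡ suc (m ℕ.+ m)
  ¬2∣⇒odd zero          ¬2∣n = ⊥-elim (¬2∣n (2 ∣0))
  ¬2∣⇒odd (suc zero)    ¬2∣n = 0 , refl
  ¬2∣⇒odd (suc (suc n)) ¬2∣n with ¬2∣⇒odd n (¬2∣n ∘ ∣m∣n⇒∣m+n (∣-refl {2}))
  ... | m , refl = suc m , cong (suc ∘ suc) (sym (ℕₚ.+-suc m m))

  sgn*θ-natural : ∀ {ν n} K → (¬ 2 ∣ n) ⊎ (2 ∣ ν) → ∃[ u ] sgn ν * θ K n ≡ + u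
  sgn*θ-natural {ν} {n} K (inj₁ ¬2∣n) with ¬2∣⇒odd n ¬2∣n
  ... | m , refl =
    0 , trans (cong (sgn ν *_) (trans (θ-closed-form K _) (cong +_ (dilate-odd (λ m → pk m K) m)))) (*-zeroʳ (sgn ν))
  sgn*θ-natural {ν} {n} K (inj₂ 2∣ν) =
    _ , trans (cong₂ _*_ (sgn-even 2∣ν) (θ-closed-form K n)) (*-identityˡ _)

  alternating : (ℕ → ℕ) → ℕ → ℕ → ℤ
  alternating a m zero    = + 0
  alternating a m (suc M) = + a m - alternating a (suc m) M

  alternating-snoc : ∀ a M m → alternating a m (suc M) ≡ alternating a m M + sgn M * + a (m ℕ.+ M)
  alternating-snoc a zero    m = begin
    + a m - + 0           ≡⟨ +-identityʳ (+ a m) ⟩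
    + a m                 ≡⟨ cong (+_ ∘ a) (ℕₚ.+-identityʳ m) ⟨
    + a (m ℕ.+ 0)         ≡⟨ *-identityˡ _ ⟨
    + 1 * + a (m ℕ.+ 0)   ≡⟨ +-identityˡ _ ⟨
    + 0 + + 1 * + a (m ℕ.+ 0) ∎
    where open ≡-Reasoning
  alternating-snoc a (suc M) m = begin
    + a m - alternating a (suc m) (suc M)
      ≡⟨ cong (λ t → + a m - t) (alternating-snoc a M (suc m)) ⟩
    + a m - (alternating a (suc m) M + sgn M * + a (suc m ℕ.+ M))
      ≡⟨ distribute (+ a m) (alternating a (suc m) M) (sgn M) (+ a (suc m ℕ.+ M)) ⟩
    + a m - alternating a (suc m) M + - sgn M * + a (suc m ℕ.+ M)
      ≡⟨ cong (λ t → alternating a m (suc M) + - sgn M * + a t) (ℕₚ.+-suc m M) ⟨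
    alternating a m (suc M) + - sgn M * + a (m ℕ.+ suc M)
      ∎
    where
    open ≡-Reasoning
    distribute : ∀ x y s z → x - (y + s * z) ≡ x - y + - s * z
    distribute = solve-∀

  altSum-split : ∀ n ν M → altSum n (ν ℕ.+ M) ≡ altSum n ν - sgn ν * alternating (λ τ → ppSub n (τ ²)) (suc ν) M
  altSum-split n ν zero = begin
    altSum n (ν ℕ.+ 0)          ≡⟨ cong (altSum n) (ℕₚ.+-identityʳ ν) ⟩
    altSum n ν                  ≡⟨ +-identityʳ (altSum n ν) ⟨
    altSum n ν - + 0            ≡⟨ cong (λ t → altSum n ν - t) (*-zeroʳ (sgn ν)) ⟨
    altSum n ν - sgn ν * + 0    ∎
    where open ≡-Reasoning
  altSum-split n ν (suc M) = begin
    altSum n (ν ℕ.+ suc M)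
      ≡⟨ cong (altSum n) (ℕₚ.+-suc ν M) ⟩
    altSum n (ν ℕ.+ M) + - sgn (ν ℕ.+ M) * + A (suc (ν ℕ.+ M))
      ≡⟨ cong₂ (λ x s → x + - s * + A (suc (ν ℕ.+ M))) (altSum-split n ν M) (sgn-+ ν M) ⟩
    altSum n ν - sgn ν * alternating A (suc ν) M + - (sgn ν * sgn M) * + A (suc ν ℕ.+ M)
      ≡⟨ factor (altSum n ν) (sgn ν) (alternating A (suc ν) M) (sgn M) (+ A (suc ν ℕ.+ M)) ⟩
    altSum n ν - sgn ν * (alternating A (suc ν) M + sgn M * + A (suc ν ℕ.+ M))
      ≡⟨ cong (λ t → altSum n ν - sgn ν * t) (alternating-snoc A M (suc ν)) ⟨
    altSum n ν - sgn ν * alternating A (suc ν) (suc M)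
      ∎
    where
    open ≡-Reasoning
    A : ℕ → ℕ
    A τ = ppSub n (τ ²)
    factor : ∀ X s F t x → X - s * F + - (s * t) * x ≡ X - s * (F + t * x)
    factor = solve-∀

  alternating-bounded : ∀ {a} → (∀ τ → a (suc τ) ≤ a τ) → ∀ M m → ∃[ t ] alternating a m M ≡ + t × t ≤ a m
  alternating-bounded antitone zero    m = 0 , refl , z≤n
  alternating-bounded antitone (suc M) m with alternating-bounded antitone M (suc m)
  ... | t , eq , t≤a[1+m] =
    _ , trans (cong (_-_ (+ _)) eq) (sym (+-∸ (ℕₚ.≤-trans t≤a[1+m] (antitone m)))) , ℕₚ.m∸n≤m _ t

  alternating-positive : ∀ {a} → (∀ τ → a (suc τ) ≤ a τ) → ∀ {M m t} →
    alternating a m (suc M) ≡ + t → a (suc m) < a m → 0 < t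
  alternating-positive {a} antitone {M} {m} eq a[1+m]<a[m] with alternating-bounded antitone M (suc m)
  ... | t′ , eq′ , t′≤a[1+m] =
    subst (0 <_) a[m]∸t′≡t (ℕₚ.m<n⇒0<n∸m (ℕₚ.≤-<-trans t′≤a[1+m] a[1+m]<a[m]))
    where
    a[m]∸t′≡t : a m ∸ t′ ≡ _
    a[m]∸t′≡t = +-injective
      (trans (+-∸ (ℕₚ.≤-trans t′≤a[1+m] (antitone m))) (trans (cong (_-_ (+ a m)) (sym eq′)) eq))

  D≡sgn*θ+2*alternating : ∀ ν n M → n ℕ.+ n ≤ ν ℕ.+ M →
    D ν n ≡ sgn ν * θ (ν ℕ.+ M) n + + 2 * alternating (λ τ → ppSub n (τ ²)) (suc ν) M
  D≡sgn*θ+2*alternating ν n M 2n≤ν+M = begin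
    s * (P + + 2 * altSum n ν)
      ≡⟨ regroup s P (altSum n ν) T ⟩
    s * (P + + 2 * (altSum n ν - s * T)) + + 2 * (s * s * T)
      ≡⟨ cong₂ (λ x y → s * (P + + 2 * x) + + 2 * (y * T)) (sym (altSum-split n ν M)) (sgn-square ν) ⟩
    s * (P + + 2 * altSum n (ν ℕ.+ M)) + + 2 * (+ 1 * T)
      ≡⟨ cong₂ (λ x y → s * x + + 2 * y) (θ-stable 2n≤ν+M) (sym (*-identityˡ T)) ⟨
    s * θ (ν ℕ.+ M) n + + 2 * T
      ∎
    where
    open ≡-Reasoning
    s = sgn ν
    P = + pp n
    T = alternating (λ τ → ppSub n (τ ²)) (suc ν) M
    regroup : ∀ s P X T → s * (P + + 2 * X) ≡ s * (P + + 2 * (X - s * T)) + + 2 * (s * s * T)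
    regroup = solve-∀

  ²-<-suc : ∀ τ → τ ² < suc τ ²
  ²-<-suc τ = ℕₚ.*-mono-< (ℕₚ.n<1+n τ) (ℕₚ.n<1+n τ)

  D-natural : ∀ ν n → (¬ 2 ∣ n) ⊎ (2 ∣ ν) →
    ∃[ u ] ∃[ t ] D ν n ≡ + (u ℕ.+ 2 ℕ.* t) × (suc ν ² ≤ n → 0 < t)
  D-natural ν n parity = decompose (sgn*θ-natural (ν ℕ.+ M) parity) (alternating-bounded A-antitone M (suc ν))
    where
    -- Any M with 2n ≤ ν + M would do; M ≥ 1 also makes the tail nonempty.
    M : ℕ
    M = suc (n ℕ.+ n)
    A : ℕ → ℕ
    A τ = ppSub n (τ ²)
    A-antitone : ∀ τ → A (suc τ) ≤ A τ
    A-antitone τ = ppSub-antitone n (ℕₚ.<⇒≤ (²-<-suc τ))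
    decompose : ∃[ u ] sgn ν * θ (ν ℕ.+ M) n ≡ + u → ∃[ t ] alternating A (suc ν) M ≡ + t × t ≤ A (suc ν) →
      ∃[ u ] ∃[ t ] D ν n ≡ + (u ℕ.+ 2 ℕ.* t) × (suc ν ² ≤ n → 0 < t)
    decompose (u , sθ≡u) (t , T≡t , _) = u , t , D≡u+2t ,
      λ [1+ν]²≤n → alternating-positive A-antitone {M = n ℕ.+ n} {m = suc ν} T≡t
                     (ppSub-strict (²-<-suc (suc ν)) [1+ν]²≤n)
      where
      D≡u+2t : D ν n ≡ + (u ℕ.+ 2 ℕ.* t)
      D≡u+2t = begin
        D ν n
          ≡⟨ D≡sgn*θ+2*alternating ν n M (ℕₚ.≤-trans (ℕₚ.n≤1+n (n ℕ.+ n)) (ℕₚ.m≤n+m M ν)) ⟩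
        sgn ν * θ (ν ℕ.+ M) n + + 2 * alternating A (suc ν) M
          ≡⟨ cong₂ (λ x y → x + + 2 * y) sθ≡u T≡t ⟩
        + u + + 2 * + t
          ≡⟨ cong (_+_ (+ u)) (pos-* 2 t) ⟨
        + u + + (2 ℕ.* t)
          ≡⟨ pos-+ u (2 ℕ.* t) ⟨
        + (u ℕ.+ 2 ℕ.* t)
          ∎
        where open ≡-Reasoning

open import Data.Nat using (ℕ; _≤_; _*_; _+_)
open import Data.Nat.Divisibility using (_∣_)
open import Data.Integer using (+_) renaming (_≤_ to _≤ℤ_; _<_ to _<ℤ_)
open import Data.Sum using (_⊎_)
open import Data.Product using (_×_)
open import Relation.Nullary using (¬_)

open import Data.Nat using (z≤n)
open import Data.Nat.Properties using (+-comm; m≤m+n; m≤n+m; ≤-trans; <-≤-trans)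
open import Data.Integer using (+≤+; +<+)
open PowerSeries using (D-natural)

corollary3p1 : ∀ (ν n : ℕ) → 1 ≤ ν → ((¬ 2 ∣ n) ⊎ (2 ∣ ν)) →
    (+ 0 ≤ℤ D ν n) × ((ν + 1) * (ν + 1) ≤ n → + 0 <ℤ D ν n)
corollary3p1 ν n _ parity with D-natural ν n parity
... | u , t , D≡u+2t , t>0 =
  subst (+ 0 ≤ℤ_) (sym D≡u+2t) (+≤+ z≤n) ,
  λ [ν+1]²≤n → subst (+ 0 <ℤ_) (sym D≡u+2t)
    (+<+ (<-≤-trans (t>0 (subst (λ x → x * x ≤ n) (+-comm ν 1) [ν+1]²≤n))
                    (≤-trans (m≤m+n t (1 * t)) (m≤n+m (2 * t) u))))
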